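{- Let $\tau,\sigma$ be closed types and $f,g\in\mathrm{Val}(\tau\to\sigma)$. If $\emptyset;\emptyset\vdash f\,u\cong^{ctx}_{\downarrow} g\,u:\sigma$ for every $u\in\mathrm{Val}(\tau)$, then $\emptyset;\emptyset\vdash f\cong^{ctx}_{\downarrow} g:\tau\to\sigma$.
   Context: Language. Types: $\tau ::= \alpha \mid \mathbf{1} \mid \tau_1\times\tau_2 \mid \tau_1\to\tau_2 \mid \mu\alpha.(\tau_1+\dots+\tau_n) \mid \forall\alpha.\tau$. Values: $v ::= x \mid \langle\rangle \mid \langle v_1,v_2\rangle \mid \lambda x.e \mid \mathsf{in}_i\,v \mid \Lambda\alpha.e$. Terms: $e ::= v \mid ? \mid \mathsf{proj}_i\,v \mid v\,e \mid \mathsf{case}\,v\,\mathsf{of}\,(\mathsf{in}_1 x_1\Rightarrow e_1\mid\dots\mid \mathsf{in}_n x_n\Rightarrow e_n) \mid v[\tau]$. Evaluation contexts $E ::= [\,]\mid v\,E$. Reduction $\mapsto$: $\mathsf{proj}_i\langle v_1,v_2\rangle\mapsto v_i$; $(\lambda x.e)\,v\mapsto e[v/x]$; $(\Lambda\alpha.e)[\tau]\mapsto e[\tau/\alpha]$; $\mathsf{case}\,(\mathsf{in}_j v)\,\mathsf{of}(\dots\mid\mathsf{in}_j x_j\Rightarrow e_j\mid\dots)\mapsto e_j[v/x_j]$; $?\mapsto\underline n$ for each $n\in\mathbb N$ ($\mathsf{nat}=\mu\alpha.(\mathbf 1+\alpha)$, $\underline 0=\mathsf{in}_1\langle\rangle$,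 $\underline{n+1}=\mathsf{in}_2\underline n$); $v\,e\mapsto v\,e'$ if $e\mapsto e'$. Typing $\Delta;\Gamma\vdash e:\tau$ is the standard one for this call-by-value polymorphic lambda calculus with iso-recursive sum types and $?:\mathsf{nat}$. $\mathrm{Val}(\tau)$ is the set of closed values of closed type $\tau$. $e\downarrow$ means $e\mapsto^* v$ for some value $v$. A type-indexed relation is a set of tuples $(\Delta,\Gamma,e,e',\tau)$ with $e,e'$ both of type $\tau$ in $\Delta;\Gamma$. It is compatible if it relates each variable to itself, $\langle\rangle$ to $\langle\rangle$, $?$ to $?$, and relates terms built by the same term constructor from related immediate subterms. A precongruence is a reflexive, transitive, compatible type-indexed relation; it is may-adequate if whenever it relates closed $e,e'$, $e\downarrow$ implies $e'\downarrow$. May-contextual approximation $\lesssim^{ctx}_{\downarrow}$ is the largest may-adequate precongruence and $\cong^{ctx}_{\downarrow}$ is its symmetrization (related in both directions). -}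

module Defs where

open import Level using (0ℓ)
open import Data.Nat using (ℕ; zero; suc; _<_)
open import Data.List using (List; []; _∷_)
open import Data.Maybe using (Maybe; just; nothing)
open import Data.Product using (Σ; _×_; _,_)
open import Relation.Binary.PropositionalEquality using (_≡_)
open import Relation.Binary.Construct.Closure.ReflexiveTransitive using (Star)
open import Data.List.Relation.Binary.Pointwise using (Pointwise)
open import Data.List.Relation.Unary.All using (All)

-- Types (de Bruijn type variables; μ binds one type variable over an
-- n-ary sum given as a list of summands; ∀' binds one type variable)

infixr 7 _⇒_
infix 9 _[_]ᵗ _[_]ᵀ _[_]ᵛ
infix 3 _⨾_⊢ᵛ_∶_ _⨾_⊢_∶_ _⨾_⊢_≲ctx_∶_ _⨾_⊢_≅ctx_∶_
infixr 8 _⊗_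

data Ty : Set where
  tvar : ℕ → Ty
  𝟏    : Ty
  _⊗_  : Ty → Ty → Ty
  _⇒_  : Ty → Ty → Ty
  μ    : List Ty → Ty
  ∀'   : Ty → Ty

at : {A : Set} → List A → ℕ → Maybe A
at []       _       = nothing
at (x ∷ xs) zero    = just x
at (x ∷ xs) (suc n) = at xs n

ext : (ℕ → ℕ) → ℕ → ℕ
ext ρ zero    = zero
ext ρ (suc n) = suc (ρ n)

single : {A : Set} → A → (ℕ → A) → ℕ → A
single a f zero    = a
single a f (suc n) = f n

mutual
  renTy : (ℕ → ℕ) → Ty → Ty
  renTy ρ (tvar n) = tvar (ρ n)
  renTy ρ 𝟏        = 𝟏
  renTy ρ (a ⊗ b)  = renTy ρ a ⊗ renTy ρ b
  renTy ρ (a ⇒ b)  = renTy ρ a ⇒ renTy ρ b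
  renTy ρ (μ as)   = μ (renTys (ext ρ) as)
  renTy ρ (∀' a)   = ∀' (renTy (ext ρ) a)

  renTys : (ℕ → ℕ) → List Ty → List Ty
  renTys ρ []       = []
  renTys ρ (a ∷ as) = renTy ρ a ∷ renTys ρ as

extsTy : (ℕ → Ty) → ℕ → Ty
extsTy s zero    = tvar zero
extsTy s (suc n) = renTy suc (s n)

mutual
  substTy : (ℕ → Ty) → Ty → Ty
  substTy s (tvar n) = s n
  substTy s 𝟏        = 𝟏
  substTy s (a ⊗ b)  = substTy s a ⊗ substTy s b
  substTy s (a ⇒ b)  = substTy s a ⇒ substTy s b
  substTy s (μ as)   = μ (substTys (extsTy s) as)
  substTy s (∀' a)   = ∀' (substTy (extsTy s) a)

  substTys : (ℕ → Ty) → List Ty → List Ty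
  substTys s []       = []
  substTys s (a ∷ as) = substTy s a ∷ substTys s as

-- τ [ σ ]ᵗ  is  τ[σ/α]  (α = type variable 0)
_[_]ᵗ : Ty → Ty → Ty
τ [ σ ]ᵗ = substTy (single σ tvar) τ

-- nat = μα.(1 + α)
nat : Ty
nat = μ (𝟏 ∷ tvar 0 ∷ [])

data WfTy (Δ : ℕ) : Ty → Set where
  wf-var  : ∀ {n} → n < Δ → WfTy Δ (tvar n)
  wf-𝟏    : WfTy Δ 𝟏
  wf-⊗    : ∀ {a b} → WfTy Δ a → WfTy Δ b → WfTy Δ (a ⊗ b)
  wf-⇒    : ∀ {a b} → WfTy Δ a → WfTy Δ b → WfTy Δ (a ⇒ b)
  wf-μ    : ∀ {as} → All (WfTy (suc Δ)) as → WfTy Δ (μ as)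
  wf-∀    : ∀ {a} → WfTy (suc Δ) a → WfTy Δ (∀' a)

-- Values and terms (de Bruijn term variables; ƛ and case branches bind
-- one term variable, Λ binds one type variable). Injection indices are
-- 0-based: inj 0 is the paper's in_1.

infixr 5 _·_

mutual
  data Val : Set where
    var   : ℕ → Val
    ⟨⟩    : Val
    ⟨_,_⟩ : Val → Val → Val
    ƛ     : Tm → Val
    inj   : ℕ → Val → Val
    Λ     : Tm → Val

  data Tm : Set where
    val   : Val → Tm
    ¿     : Tm
    π₁    : Val → Tm
    π₂    : Val → Tm
    _·_   : Val → Tm → Tm
    case  : Val → List Tm → Tm
    _⟦_⟧  : Val → Ty → Tm

numeral : ℕ → Val
numeral zero    = inj 0 ⟨⟩
numeral (suc n) = inj 1 (numeral n)

mutual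
  renV : (ℕ → ℕ) → Val → Val
  renV ρ (var n)     = var (ρ n)
  renV ρ ⟨⟩          = ⟨⟩
  renV ρ ⟨ v , w ⟩   = ⟨ renV ρ v , renV ρ w ⟩
  renV ρ (ƛ e)       = ƛ (renT (ext ρ) e)
  renV ρ (inj i v)   = inj i (renV ρ v)
  renV ρ (Λ e)       = Λ (renT ρ e)

  renT : (ℕ → ℕ) → Tm → Tm
  renT ρ (val v)     = val (renV ρ v)
  renT ρ ¿           = ¿
  renT ρ (π₁ v)      = π₁ (renV ρ v)
  renT ρ (π₂ v)      = π₂ (renV ρ v)
  renT ρ (v · e)     = renV ρ v · renT ρ e
  renT ρ (case v es) = case (renV ρ v) (renTs (ext ρ) es)
  renT ρ (v ⟦ τ ⟧)   = renV ρ v ⟦ τ ⟧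

  renTs : (ℕ → ℕ) → List Tm → List Tm
  renTs ρ []       = []
  renTs ρ (e ∷ es) = renT ρ e ∷ renTs ρ es

mutual
  tsubV : (ℕ → Ty) → Val → Val
  tsubV s (var n)     = var n
  tsubV s ⟨⟩          = ⟨⟩
  tsubV s ⟨ v , w ⟩   = ⟨ tsubV s v , tsubV s w ⟩
  tsubV s (ƛ e)       = ƛ (tsubT s e)
  tsubV s (inj i v)   = inj i (tsubV s v)
  tsubV s (Λ e)       = Λ (tsubT (extsTy s) e)

  tsubT : (ℕ → Ty) → Tm → Tm
  tsubT s (val v)     = val (tsubV s v)
  tsubT s ¿           = ¿
  tsubT s (π₁ v)      = π₁ (tsubV s v)
  tsubT s (π₂ v)      = π₂ (tsubV s v)
  tsubT s (v · e)     = tsubV s v · tsubT s e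
  tsubT s (case v es) = case (tsubV s v) (tsubTs s es)
  tsubT s (v ⟦ τ ⟧)   = tsubV s v ⟦ substTy s τ ⟧

  tsubTs : (ℕ → Ty) → List Tm → List Tm
  tsubTs s []       = []
  tsubTs s (e ∷ es) = tsubT s e ∷ tsubTs s es

extsV : (ℕ → Val) → ℕ → Val
extsV s zero    = var zero
extsV s (suc n) = renV suc (s n)

-- shifting type variables of the substituted values when going under Λ
tshiftS : (ℕ → Val) → ℕ → Val
tshiftS s n = tsubV (λ k → tvar (suc k)) (s n)

mutual
  subV : (ℕ → Val) → Val → Val
  subV s (var n)     = s n
  subV s ⟨⟩          = ⟨⟩
  subV s ⟨ v , w ⟩   = ⟨ subV s v , subV s w ⟩
  subV s (ƛ e)       = ƛ (subT (extsV s) e)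
  subV s (inj i v)   = inj i (subV s v)
  subV s (Λ e)       = Λ (subT (tshiftS s) e)

  subT : (ℕ → Val) → Tm → Tm
  subT s (val v)     = val (subV s v)
  subT s ¿           = ¿
  subT s (π₁ v)      = π₁ (subV s v)
  subT s (π₂ v)      = π₂ (subV s v)
  subT s (v · e)     = subV s v · subT s e
  subT s (case v es) = case (subV s v) (subTs (extsV s) es)
  subT s (v ⟦ τ ⟧)   = subV s v ⟦ τ ⟧

  subTs : (ℕ → Val) → List Tm → List Tm
  subTs s []       = []
  subTs s (e ∷ es) = subT s e ∷ subTs s es

-- e [ v ]ᵛ is e[v/x] (x = term variable 0); e [ τ ]ᵀ is e[τ/α]
_[_]ᵛ : Tm → Val → Tm
e [ v ]ᵛ = subT (single v var) e

_[_]ᵀ : Tm → Ty → Tm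
e [ τ ]ᵀ = tsubT (single τ tvar) e

Ctx : Set
Ctx = List Ty

data _∋_∶_ : Ctx → ℕ → Ty → Set where
  here  : ∀ {Γ τ} → (τ ∷ Γ) ∋ zero ∶ τ
  there : ∀ {Γ τ σ n} → Γ ∋ n ∶ τ → (σ ∷ Γ) ∋ suc n ∶ τ

↑ : Ctx → Ctx
↑ Γ = renTys suc Γ

WfCtx : ℕ → Ctx → Set
WfCtx Δ Γ = All (WfTy Δ) Γ

mutual
  data _⨾_⊢ᵛ_∶_ : ℕ → Ctx → Val → Ty → Set where
    ⊢var  : ∀ {Δ Γ x τ} → Γ ∋ x ∶ τ → Δ ⨾ Γ ⊢ᵛ var x ∶ τ
    ⊢⟨⟩   : ∀ {Δ Γ} → Δ ⨾ Γ ⊢ᵛ ⟨⟩ ∶ 𝟏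
    ⊢pair : ∀ {Δ Γ v w τ σ} → Δ ⨾ Γ ⊢ᵛ v ∶ τ → Δ ⨾ Γ ⊢ᵛ w ∶ σ
            → Δ ⨾ Γ ⊢ᵛ ⟨ v , w ⟩ ∶ τ ⊗ σ
    ⊢ƛ    : ∀ {Δ Γ e τ σ} → WfTy Δ τ → Δ ⨾ (τ ∷ Γ) ⊢ e ∶ σ
            → Δ ⨾ Γ ⊢ᵛ ƛ e ∶ τ ⇒ σ
    ⊢inj  : ∀ {Δ Γ i v as a} → WfTy Δ (μ as) → at as i ≡ just a
            → Δ ⨾ Γ ⊢ᵛ v ∶ a [ μ as ]ᵗ → Δ ⨾ Γ ⊢ᵛ inj i v ∶ μ as
    ⊢Λ    : ∀ {Δ Γ e τ} → suc Δ ⨾ ↑ Γ ⊢ e ∶ τ → Δ ⨾ Γ ⊢ᵛ Λ e ∶ ∀' τ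

  data _⨾_⊢_∶_ : ℕ → Ctx → Tm → Ty → Set where
    ⊢val  : ∀ {Δ Γ v τ} → Δ ⨾ Γ ⊢ᵛ v ∶ τ → Δ ⨾ Γ ⊢ val v ∶ τ
    ⊢¿    : ∀ {Δ Γ} → Δ ⨾ Γ ⊢ ¿ ∶ nat
    ⊢π₁   : ∀ {Δ Γ v τ σ} → Δ ⨾ Γ ⊢ᵛ v ∶ τ ⊗ σ → Δ ⨾ Γ ⊢ π₁ v ∶ τ
    ⊢π₂   : ∀ {Δ Γ v τ σ} → Δ ⨾ Γ ⊢ᵛ v ∶ τ ⊗ σ → Δ ⨾ Γ ⊢ π₂ v ∶ σ
    ⊢app  : ∀ {Δ Γ v e τ σ} → Δ ⨾ Γ ⊢ᵛ v ∶ τ ⇒ σ → Δ ⨾ Γ ⊢ e ∶ τ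
            → Δ ⨾ Γ ⊢ v · e ∶ σ
    ⊢case : ∀ {Δ Γ v as es σ} → Δ ⨾ Γ ⊢ᵛ v ∶ μ as
            → Pointwise (λ a e → Δ ⨾ (a [ μ as ]ᵗ ∷ Γ) ⊢ e ∶ σ) as es
            → Δ ⨾ Γ ⊢ case v es ∶ σ
    ⊢tapp : ∀ {Δ Γ v τ σ} → Δ ⨾ Γ ⊢ᵛ v ∶ ∀' τ → WfTy Δ σ
            → Δ ⨾ Γ ⊢ v ⟦ σ ⟧ ∶ τ [ σ ]ᵗ

Valof : Ty → Val → Set
Valof τ v = 0 ⨾ [] ⊢ᵛ v ∶ τ

infix 4 _↦_

data _↦_ : Tm → Tm → Set where
  β-π₁   : ∀ {v w} → π₁ ⟨ v , w ⟩ ↦ val v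
  β-π₂   : ∀ {v w} → π₂ ⟨ v , w ⟩ ↦ val w
  β-ƛ    : ∀ {e v} → ƛ e · val v ↦ e [ v ]ᵛ
  β-Λ    : ∀ {e τ} → Λ e ⟦ τ ⟧ ↦ e [ τ ]ᵀ
  β-case : ∀ {j v es e} → at es j ≡ just e → case (inj j v) es ↦ e [ v ]ᵛ
  β-¿    : (n : ℕ) → ¿ ↦ val (numeral n)
  ξ-app  : ∀ {v e e'} → e ↦ e' → v · e ↦ v · e'

_⇓ : Tm → Set
e ⇓ = Σ Val (λ v → Star _↦_ e (val v))

Typed : ℕ → Ctx → Tm → Ty → Set
Typed Δ Γ e τ = WfCtx Δ Γ × (Δ ⨾ Γ ⊢ e ∶ τ)

TRel : Set₁
TRel = ℕ → Ctx → Tm → Tm → Ty → Set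

record TypeIndexedRel : Set₁ where
  field
    R     : TRel
    typed : ∀ {Δ Γ e e' τ} → R Δ Γ e e' τ → Typed Δ Γ e τ × Typed Δ Γ e' τ

data RelBranches (R : TRel) (Δ : ℕ) (Γ : Ctx) (m : Ty) (σ : Ty)
     : List Ty → List Tm → List Tm → Set where
  []  : RelBranches R Δ Γ m σ [] [] []
  _∷_ : ∀ {a as e e' es es'} → R Δ (a [ m ]ᵗ ∷ Γ) e e' σ
        → RelBranches R Δ Γ m σ as es es'
        → RelBranches R Δ Γ m σ (a ∷ as) (e ∷ es) (e' ∷ es')

record Compatible (R : TRel) : Set where
  field
    c-var  : ∀ {Δ Γ x τ} → WfCtx Δ Γ → Γ ∋ x ∶ τ
             → R Δ Γ (val (var x)) (val (var x)) τ
    c-⟨⟩   : ∀ {Δ Γ} → WfCtx Δ Γ → R Δ Γ (val ⟨⟩) (val ⟨⟩) 𝟏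
    c-¿    : ∀ {Δ Γ} → WfCtx Δ Γ → R Δ Γ ¿ ¿ nat
    c-pair : ∀ {Δ Γ v v' w w' τ σ}
             → R Δ Γ (val v) (val v') τ → R Δ Γ (val w) (val w') σ
             → R Δ Γ (val ⟨ v , w ⟩) (val ⟨ v' , w' ⟩) (τ ⊗ σ)
    c-ƛ    : ∀ {Δ Γ e e' τ σ} → WfTy Δ τ → R Δ (τ ∷ Γ) e e' σ
             → R Δ Γ (val (ƛ e)) (val (ƛ e')) (τ ⇒ σ)
    c-inj  : ∀ {Δ Γ i v v' as a} → WfTy Δ (μ as) → at as i ≡ just a
             → R Δ Γ (val v) (val v') (a [ μ as ]ᵗ)
             → R Δ Γ (val (inj i v)) (val (inj i v')) (μ as)
    c-Λ    : ∀ {Δ Γ e e' τ} → R (suc Δ) (↑ Γ) e e' τ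
             → R Δ Γ (val (Λ e)) (val (Λ e')) (∀' τ)
    c-π₁   : ∀ {Δ Γ v v' τ σ} → R Δ Γ (val v) (val v') (τ ⊗ σ)
             → R Δ Γ (π₁ v) (π₁ v') τ
    c-π₂   : ∀ {Δ Γ v v' τ σ} → R Δ Γ (val v) (val v') (τ ⊗ σ)
             → R Δ Γ (π₂ v) (π₂ v') σ
    c-app  : ∀ {Δ Γ v v' e e' τ σ} → R Δ Γ (val v) (val v') (τ ⇒ σ)
             → R Δ Γ e e' τ → R Δ Γ (v · e) (v' · e') σ
    c-case : ∀ {Δ Γ v v' as es es' σ} → R Δ Γ (val v) (val v') (μ as)
             → RelBranches R Δ Γ (μ as) σ as es es'
             → R Δ Γ (case v es) (case v' es') σ
    c-tapp : ∀ {Δ Γ v v' τ σ} → R Δ Γ (val v) (val v') (∀' τ) → WfTy Δ σ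
             → R Δ Γ (v ⟦ σ ⟧) (v' ⟦ σ ⟧) (τ [ σ ]ᵗ)

record IsMayAdequatePrecongruence (T : TypeIndexedRel) : Set where
  open TypeIndexedRel T
  field
    refl'      : ∀ {Δ Γ e τ} → Typed Δ Γ e τ → R Δ Γ e e τ
    trans'     : ∀ {Δ Γ e₁ e₂ e₃ τ} → R Δ Γ e₁ e₂ τ → R Δ Γ e₂ e₃ τ
                 → R Δ Γ e₁ e₃ τ
    compatible : Compatible R
    adequate   : ∀ {e e' τ} → R 0 [] e e' τ → e ⇓ → e' ⇓

-- may-contextual approximation: the largest may-adequate precongruence,
-- i.e. the union of all may-adequate precongruences
_⨾_⊢_≲ctx_∶_ : ℕ → Ctx → Tm → Tm → Ty → Set₁
Δ ⨾ Γ ⊢ e ≲ctx e' ∶ τ =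
  Σ TypeIndexedRel (λ T → IsMayAdequatePrecongruence T
                          × TypeIndexedRel.R T Δ Γ e e' τ)

_⨾_⊢_≅ctx_∶_ : ℕ → Ctx → Tm → Tm → Ty → Set₁
Δ ⨾ Γ ⊢ e ≅ctx e' ∶ τ = (Δ ⨾ Γ ⊢ e ≲ctx e' ∶ τ) × (Δ ⨾ Γ ⊢ e' ≲ctx e ∶ τ)

module Submission where

-- It suffices to show one direction, f ≲ g, from f u ≲ g u for all closed
-- values u.  We exhibit a may-adequate precongruence relating f to g: the
-- typed reflexive-transitive closure of the "replacement" relation Rep, where
-- Rep e e' says that e' arises from e by replacing some occurrences of f by g.  Adequacy is a simulation
-- argument: if Rep e e' and e ↦ e₁, then Rep e₁ e₁' for some e₁' that
-- approximates e' in every evaluation context (CIU approximation, ⊑).  The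
-- only non-trivial step is f · w ↦ b[w] (f = ƛ b), where we take b[w'], which
-- converges in a context whenever f · w' does, hence (by the hypothesis) g · w'.

open import Defs
open import Function using (_∘_; id)
open import Data.Nat using (ℕ; zero; suc; _<_; _≤_; z≤n; s≤s)
open import Data.Nat.Properties using (≤-trans)
open import Data.List using (List; []; _∷_; _++_)
open import Data.Maybe using (just)
open import Data.Product using (Σ; _×_; _,_; proj₁; proj₂)
open import Data.List.Relation.Unary.All using (All; []; _∷_)
open import Data.List.Relation.Binary.Pointwise using (Pointwise; []; _∷_)
open import Relation.Binary.PropositionalEquality
  using (_≡_; _≗_; refl; sym; trans; cong; cong₂; subst; subst₂)
open import Relation.Binary.Construct.Closure.ReflexiveTransitive
  using (Star; ε; _◅_; _◅◅_; gmap)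

ext-cong : ∀ {ρ ρ'} → ρ ≗ ρ' → ext ρ ≗ ext ρ'
ext-cong h zero    = refl
ext-cong h (suc n) = cong suc (h n)

mutual
  renTy-cong : ∀ {ρ ρ'} → ρ ≗ ρ' → ∀ a → renTy ρ a ≡ renTy ρ' a
  renTy-cong h (tvar n) = cong tvar (h n)
  renTy-cong h 𝟏        = refl
  renTy-cong h (a ⊗ b)  = cong₂ _⊗_ (renTy-cong h a) (renTy-cong h b)
  renTy-cong h (a ⇒ b)  = cong₂ _⇒_ (renTy-cong h a) (renTy-cong h b)
  renTy-cong h (μ as)   = cong μ (renTys-cong (ext-cong h) as)
  renTy-cong h (∀' a)   = cong ∀' (renTy-cong (ext-cong h) a)

  renTys-cong : ∀ {ρ ρ'} → ρ ≗ ρ' → ∀ as → renTys ρ as ≡ renTys ρ' as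
  renTys-cong h []       = refl
  renTys-cong h (a ∷ as) = cong₂ _∷_ (renTy-cong h a) (renTys-cong h as)

extsTy-cong : ∀ {s t} → s ≗ t → extsTy s ≗ extsTy t
extsTy-cong h zero    = refl
extsTy-cong h (suc n) = cong (renTy suc) (h n)

mutual
  substTy-cong : ∀ {s t} → s ≗ t → ∀ a → substTy s a ≡ substTy t a
  substTy-cong h (tvar n) = h n
  substTy-cong h 𝟏        = refl
  substTy-cong h (a ⊗ b)  = cong₂ _⊗_ (substTy-cong h a) (substTy-cong h b)
  substTy-cong h (a ⇒ b)  = cong₂ _⇒_ (substTy-cong h a) (substTy-cong h b)
  substTy-cong h (μ as)   = cong μ (substTys-cong (extsTy-cong h) as)
  substTy-cong h (∀' a)   = cong ∀' (substTy-cong (extsTy-cong h) a)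

  substTys-cong : ∀ {s t} → s ≗ t → ∀ as → substTys s as ≡ substTys t as
  substTys-cong h []       = refl
  substTys-cong h (a ∷ as) = cong₂ _∷_ (substTy-cong h a) (substTys-cong h as)

ext-∘ : ∀ ρ ρ' → ext ρ ∘ ext ρ' ≗ ext (ρ ∘ ρ')
ext-∘ ρ ρ' zero    = refl
ext-∘ ρ ρ' (suc n) = refl

mutual
  renTy-∘ : ∀ ρ ρ' a → renTy ρ (renTy ρ' a) ≡ renTy (ρ ∘ ρ') a
  renTy-∘ ρ ρ' (tvar n) = refl
  renTy-∘ ρ ρ' 𝟏        = refl
  renTy-∘ ρ ρ' (a ⊗ b)  = cong₂ _⊗_ (renTy-∘ ρ ρ' a) (renTy-∘ ρ ρ' b)
  renTy-∘ ρ ρ' (a ⇒ b)  = cong₂ _⇒_ (renTy-∘ ρ ρ' a) (renTy-∘ ρ ρ' b)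
  renTy-∘ ρ ρ' (μ as)   =
    cong μ (trans (renTys-∘ (ext ρ) (ext ρ') as) (renTys-cong (ext-∘ ρ ρ') as))
  renTy-∘ ρ ρ' (∀' a)   =
    cong ∀' (trans (renTy-∘ (ext ρ) (ext ρ') a) (renTy-cong (ext-∘ ρ ρ') a))

  renTys-∘ : ∀ ρ ρ' as → renTys ρ (renTys ρ' as) ≡ renTys (ρ ∘ ρ') as
  renTys-∘ ρ ρ' []       = refl
  renTys-∘ ρ ρ' (a ∷ as) = cong₂ _∷_ (renTy-∘ ρ ρ' a) (renTys-∘ ρ ρ' as)

extsTy-ext : ∀ s ρ → extsTy s ∘ ext ρ ≗ extsTy (s ∘ ρ)
extsTy-ext s ρ zero    = refl
extsTy-ext s ρ (suc n) = refl

mutual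
  substTy-renTy : ∀ s ρ a → substTy s (renTy ρ a) ≡ substTy (s ∘ ρ) a
  substTy-renTy s ρ (tvar n) = refl
  substTy-renTy s ρ 𝟏        = refl
  substTy-renTy s ρ (a ⊗ b)  = cong₂ _⊗_ (substTy-renTy s ρ a) (substTy-renTy s ρ b)
  substTy-renTy s ρ (a ⇒ b)  = cong₂ _⇒_ (substTy-renTy s ρ a) (substTy-renTy s ρ b)
  substTy-renTy s ρ (μ as)   =
    cong μ (trans (substTys-renTys (extsTy s) (ext ρ) as) (substTys-cong (extsTy-ext s ρ) as))
  substTy-renTy s ρ (∀' a)   =
    cong ∀' (trans (substTy-renTy (extsTy s) (ext ρ) a) (substTy-cong (extsTy-ext s ρ) a))

  substTys-renTys : ∀ s ρ as → substTys s (renTys ρ as) ≡ substTys (s ∘ ρ) as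
  substTys-renTys s ρ []       = refl
  substTys-renTys s ρ (a ∷ as) = cong₂ _∷_ (substTy-renTy s ρ a) (substTys-renTys s ρ as)

ext-extsTy : ∀ ρ s → renTy (ext ρ) ∘ extsTy s ≗ extsTy (renTy ρ ∘ s)
ext-extsTy ρ s zero    = refl
ext-extsTy ρ s (suc n) = trans (renTy-∘ (ext ρ) suc (s n)) (sym (renTy-∘ suc ρ (s n)))

mutual
  renTy-substTy : ∀ ρ s a → renTy ρ (substTy s a) ≡ substTy (renTy ρ ∘ s) a
  renTy-substTy ρ s (tvar n) = refl
  renTy-substTy ρ s 𝟏        = refl
  renTy-substTy ρ s (a ⊗ b)  = cong₂ _⊗_ (renTy-substTy ρ s a) (renTy-substTy ρ s b)
  renTy-substTy ρ s (a ⇒ b)  = cong₂ _⇒_ (renTy-substTy ρ s a) (renTy-substTy ρ s b)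
  renTy-substTy ρ s (μ as)   =
    cong μ (trans (renTys-substTys (ext ρ) (extsTy s) as) (substTys-cong (ext-extsTy ρ s) as))
  renTy-substTy ρ s (∀' a)   =
    cong ∀' (trans (renTy-substTy (ext ρ) (extsTy s) a) (substTy-cong (ext-extsTy ρ s) a))

  renTys-substTys : ∀ ρ s as → renTys ρ (substTys s as) ≡ substTys (renTy ρ ∘ s) as
  renTys-substTys ρ s []       = refl
  renTys-substTys ρ s (a ∷ as) = cong₂ _∷_ (renTy-substTy ρ s a) (renTys-substTys ρ s as)

substTy-shift : ∀ s a → substTy (extsTy s) (renTy suc a) ≡ renTy suc (substTy s a)
substTy-shift s a = trans (substTy-renTy (extsTy s) suc a) (sym (renTy-substTy suc s a))

substTys-shift : ∀ s as → substTys (extsTy s) (renTys suc as) ≡ renTys suc (substTys s as)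
substTys-shift s []       = refl
substTys-shift s (a ∷ as) = cong₂ _∷_ (substTy-shift s a) (substTys-shift s as)

extsTy-extsTy : ∀ s t → substTy (extsTy s) ∘ extsTy t ≗ extsTy (substTy s ∘ t)
extsTy-extsTy s t zero    = refl
extsTy-extsTy s t (suc n) = substTy-shift s (t n)

mutual
  substTy-∘ : ∀ s t a → substTy s (substTy t a) ≡ substTy (substTy s ∘ t) a
  substTy-∘ s t (tvar n) = refl
  substTy-∘ s t 𝟏        = refl
  substTy-∘ s t (a ⊗ b)  = cong₂ _⊗_ (substTy-∘ s t a) (substTy-∘ s t b)
  substTy-∘ s t (a ⇒ b)  = cong₂ _⇒_ (substTy-∘ s t a) (substTy-∘ s t b)
  substTy-∘ s t (μ as)   =
    cong μ (trans (substTys-∘ (extsTy s) (extsTy t) as) (substTys-cong (extsTy-extsTy s t) as))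
  substTy-∘ s t (∀' a)   =
    cong ∀' (trans (substTy-∘ (extsTy s) (extsTy t) a) (substTy-cong (extsTy-extsTy s t) a))

  substTys-∘ : ∀ s t as → substTys s (substTys t as) ≡ substTys (substTy s ∘ t) as
  substTys-∘ s t []       = refl
  substTys-∘ s t (a ∷ as) = cong₂ _∷_ (substTy-∘ s t a) (substTys-∘ s t as)

extsTy-tvar : extsTy tvar ≗ tvar
extsTy-tvar zero    = refl
extsTy-tvar (suc n) = refl

mutual
  substTy-id : ∀ a → substTy tvar a ≡ a
  substTy-id (tvar n) = refl
  substTy-id 𝟏        = refl
  substTy-id (a ⊗ b)  = cong₂ _⊗_ (substTy-id a) (substTy-id b)
  substTy-id (a ⇒ b)  = cong₂ _⇒_ (substTy-id a) (substTy-id b)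
  substTy-id (μ as)   = cong μ (trans (substTys-cong extsTy-tvar as) (substTys-id as))
  substTy-id (∀' a)   = cong ∀' (trans (substTy-cong extsTy-tvar a) (substTy-id a))

  substTys-id : ∀ as → substTys tvar as ≡ as
  substTys-id []       = refl
  substTys-id (a ∷ as) = cong₂ _∷_ (substTy-id a) (substTys-id as)

ext-as-extsTy : ∀ ρ → tvar ∘ ext ρ ≗ extsTy (tvar ∘ ρ)
ext-as-extsTy ρ zero    = refl
ext-as-extsTy ρ (suc n) = refl

mutual
  renTy-as-substTy : ∀ ρ a → renTy ρ a ≡ substTy (tvar ∘ ρ) a
  renTy-as-substTy ρ (tvar n) = refl
  renTy-as-substTy ρ 𝟏        = refl
  renTy-as-substTy ρ (a ⊗ b)  = cong₂ _⊗_ (renTy-as-substTy ρ a) (renTy-as-substTy ρ b)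
  renTy-as-substTy ρ (a ⇒ b)  = cong₂ _⇒_ (renTy-as-substTy ρ a) (renTy-as-substTy ρ b)
  renTy-as-substTy ρ (μ as)   =
    cong μ (trans (renTys-as-substTys (ext ρ) as) (substTys-cong (ext-as-extsTy ρ) as))
  renTy-as-substTy ρ (∀' a)   =
    cong ∀' (trans (renTy-as-substTy (ext ρ) a) (substTy-cong (ext-as-extsTy ρ) a))

  renTys-as-substTys : ∀ ρ as → renTys ρ as ≡ substTys (tvar ∘ ρ) as
  renTys-as-substTys ρ []       = refl
  renTys-as-substTys ρ (a ∷ as) = cong₂ _∷_ (renTy-as-substTy ρ a) (renTys-as-substTys ρ as)

substTy-[]ᵗ : ∀ s a m → substTy s (a [ m ]ᵗ) ≡ (substTy (extsTy s) a) [ substTy s m ]ᵗ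
substTy-[]ᵗ s a m =
  trans (substTy-∘ s (single m tvar) a)
        (trans (substTy-cong agree a) (sym (substTy-∘ (single (substTy s m) tvar) (extsTy s) a)))
  where
    agree : substTy s ∘ single m tvar ≗ substTy (single (substTy s m) tvar) ∘ extsTy s
    agree zero    = refl
    agree (suc n) =
      sym (trans (substTy-renTy (single (substTy s m) tvar) suc (s n)) (substTy-id (s n)))

at-substTys : ∀ s as i a → at as i ≡ just a → at (substTys s as) i ≡ just (substTy s a)
at-substTys s []       i       a ()
at-substTys s (b ∷ as) zero    a refl = refl
at-substTys s (b ∷ as) (suc i) a eq   = at-substTys s as i a eq

WfRen : ℕ → ℕ → (ℕ → ℕ) → Set
WfRen Δ Δ' ρ = ∀ n → n < Δ → ρ n < Δ'

WfSub : ℕ → ℕ → (ℕ → Ty) → Set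
WfSub Δ Δ' s = ∀ n → n < Δ → WfTy Δ' (s n)

wfRen-ext : ∀ {Δ Δ' ρ} → WfRen Δ Δ' ρ → WfRen (suc Δ) (suc Δ') (ext ρ)
wfRen-ext h zero    p       = s≤s z≤n
wfRen-ext h (suc n) (s≤s p) = s≤s (h n p)

mutual
  wf-renTy : ∀ {Δ Δ' ρ a} → WfRen Δ Δ' ρ → WfTy Δ a → WfTy Δ' (renTy ρ a)
  wf-renTy h (wf-var x) = wf-var (h _ x)
  wf-renTy h wf-𝟏       = wf-𝟏
  wf-renTy h (wf-⊗ a b) = wf-⊗ (wf-renTy h a) (wf-renTy h b)
  wf-renTy h (wf-⇒ a b) = wf-⇒ (wf-renTy h a) (wf-renTy h b)
  wf-renTy h (wf-μ as)  = wf-μ (wf-renTys (wfRen-ext h) as)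
  wf-renTy h (wf-∀ a)   = wf-∀ (wf-renTy (wfRen-ext h) a)

  wf-renTys : ∀ {Δ Δ' ρ as} → WfRen Δ Δ' ρ → All (WfTy Δ) as → All (WfTy Δ') (renTys ρ as)
  wf-renTys h []       = []
  wf-renTys h (a ∷ as) = wf-renTy h a ∷ wf-renTys h as

wfSub-extsTy : ∀ {Δ Δ' s} → WfSub Δ Δ' s → WfSub (suc Δ) (suc Δ') (extsTy s)
wfSub-extsTy h zero    p       = wf-var (s≤s z≤n)
wfSub-extsTy h (suc n) (s≤s p) = wf-renTy (λ k → s≤s) (h n p)

mutual
  wf-substTy : ∀ {Δ Δ' s a} → WfSub Δ Δ' s → WfTy Δ a → WfTy Δ' (substTy s a)
  wf-substTy h (wf-var x) = h _ x
  wf-substTy h wf-𝟏       = wf-𝟏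
  wf-substTy h (wf-⊗ a b) = wf-⊗ (wf-substTy h a) (wf-substTy h b)
  wf-substTy h (wf-⇒ a b) = wf-⇒ (wf-substTy h a) (wf-substTy h b)
  wf-substTy h (wf-μ as)  = wf-μ (wf-substTys (wfSub-extsTy h) as)
  wf-substTy h (wf-∀ a)   = wf-∀ (wf-substTy (wfSub-extsTy h) a)

  wf-substTys : ∀ {Δ Δ' s as} → WfSub Δ Δ' s → All (WfTy Δ) as → All (WfTy Δ') (substTys s as)
  wf-substTys h []       = []
  wf-substTys h (a ∷ as) = wf-substTy h a ∷ wf-substTys h as

wf-mono : ∀ {Δ Δ' a} → Δ ≤ Δ' → WfTy Δ a → WfTy Δ' a
wf-mono {a = a} le w =
  subst (WfTy _) (trans (renTy-as-substTy id a) (substTy-id a))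
        (wf-renTy (λ n p → ≤-trans p le) w)

-- conversely, if a renamed type is well formed then so is the original,
-- provided ρ reflects the bound; used to strip the shift ↑ off contexts
mutual
  wf-unrenTy : ∀ {Δ Δ' ρ} a → (∀ n → ρ n < Δ' → n < Δ) → WfTy Δ' (renTy ρ a) → WfTy Δ a
  wf-unrenTy (tvar n) h (wf-var x) = wf-var (h n x)
  wf-unrenTy 𝟏        h w          = wf-𝟏
  wf-unrenTy (a ⊗ b)  h (wf-⊗ x y) = wf-⊗ (wf-unrenTy a h x) (wf-unrenTy b h y)
  wf-unrenTy (a ⇒ b)  h (wf-⇒ x y) = wf-⇒ (wf-unrenTy a h x) (wf-unrenTy b h y)
  wf-unrenTy (μ as)   h (wf-μ x)   = wf-μ (wf-unrenTys as (reflect-ext h) x)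
  wf-unrenTy (∀' a)   h (wf-∀ x)   = wf-∀ (wf-unrenTy a (reflect-ext h) x)

  wf-unrenTys : ∀ {Δ Δ' ρ} as → (∀ n → ρ n < Δ' → n < Δ)
              → All (WfTy Δ') (renTys ρ as) → All (WfTy Δ) as
  wf-unrenTys []       h _        = []
  wf-unrenTys (a ∷ as) h (x ∷ xs) = wf-unrenTy a h x ∷ wf-unrenTys as h xs

  reflect-ext : ∀ {Δ Δ' ρ} → (∀ n → ρ n < Δ' → n < Δ) → ∀ n → ext ρ n < suc Δ' → n < suc Δ
  reflect-ext h zero    p       = s≤s z≤n
  reflect-ext h (suc n) (s≤s p) = s≤s (h n p)

wfCtx-unshift : ∀ {Δ} Γ → WfCtx (suc Δ) (↑ Γ) → WfCtx Δ Γ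
wfCtx-unshift Γ = wf-unrenTys Γ (λ { n (s≤s p) → p })

FixesBelow : ℕ → (ℕ → Ty) → Set
FixesBelow Δ s = ∀ n → n < Δ → s n ≡ tvar n

fixesBelow-extsTy : ∀ {Δ s} → FixesBelow Δ s → FixesBelow (suc Δ) (extsTy s)
fixesBelow-extsTy h zero    p       = refl
fixesBelow-extsTy h (suc n) (s≤s p) = cong (renTy suc) (h n p)

mutual
  substTy-fix : ∀ {Δ s a} → FixesBelow Δ s → WfTy Δ a → substTy s a ≡ a
  substTy-fix h (wf-var x) = h _ x
  substTy-fix h wf-𝟏       = refl
  substTy-fix h (wf-⊗ a b) = cong₂ _⊗_ (substTy-fix h a) (substTy-fix h b)
  substTy-fix h (wf-⇒ a b) = cong₂ _⇒_ (substTy-fix h a) (substTy-fix h b)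
  substTy-fix h (wf-μ as)  = cong μ (substTys-fix (fixesBelow-extsTy h) as)
  substTy-fix h (wf-∀ a)   = cong ∀' (substTy-fix (fixesBelow-extsTy h) a)

  substTys-fix : ∀ {Δ s as} → FixesBelow Δ s → All (WfTy Δ) as → substTys s as ≡ as
  substTys-fix h []       = refl
  substTys-fix h (a ∷ as) = cong₂ _∷_ (substTy-fix h a) (substTys-fix h as)

∋-shift : ∀ {Γ x b} → Γ ∋ x ∶ b → ↑ Γ ∋ x ∶ renTy suc b
∋-shift here      = here
∋-shift (there p) = there (∋-shift p)

∋-unshift : ∀ {Γ x b} → ↑ Γ ∋ x ∶ b → Σ Ty (λ b₀ → (b ≡ renTy suc b₀) × (Γ ∋ x ∶ b₀))
∋-unshift {a ∷ Γ} here      = a , refl , here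
∋-unshift {a ∷ Γ} (there p) with ∋-unshift {Γ} p
... | b₀ , eq , q = b₀ , eq , there q

∋-substTys : ∀ {Γ x b} t → Γ ∋ x ∶ b → substTys t Γ ∋ x ∶ substTy t b
∋-substTys t here      = here
∋-substTys t (there p) = there (∋-substTys t p)

∋-++ : ∀ {Γ x b} Γ' → Γ ∋ x ∶ b → (Γ ++ Γ') ∋ x ∶ b
∋-++ Γ' here      = here
∋-++ Γ' (there p) = there (∋-++ Γ' p)

↑-++ : ∀ Γ Γ' → ↑ (Γ ++ Γ') ≡ ↑ Γ ++ ↑ Γ'
↑-++ []      Γ' = refl
↑-++ (a ∷ Γ) Γ' = cong (renTy suc a ∷_) (↑-++ Γ Γ')

-- typing survives extending the type context and appending term variables;
-- in particular closed values can be used in any context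
mutual
  weakenᵛ : ∀ {Δ Δ' Γ v a} Γ' → Δ ≤ Δ' → Δ ⨾ Γ ⊢ᵛ v ∶ a → Δ' ⨾ (Γ ++ Γ') ⊢ᵛ v ∶ a
  weakenᵛ Γ' le (⊢var p)      = ⊢var (∋-++ Γ' p)
  weakenᵛ Γ' le ⊢⟨⟩           = ⊢⟨⟩
  weakenᵛ Γ' le (⊢pair d e)   = ⊢pair (weakenᵛ Γ' le d) (weakenᵛ Γ' le e)
  weakenᵛ Γ' le (⊢ƛ w d)      = ⊢ƛ (wf-mono le w) (weaken Γ' le d)
  weakenᵛ Γ' le (⊢inj w eq d) = ⊢inj (wf-mono le w) eq (weakenᵛ Γ' le d)
  weakenᵛ {Γ = Γ} Γ' le (⊢Λ d) =
    ⊢Λ (subst (λ G → _ ⨾ G ⊢ _ ∶ _) (sym (↑-++ Γ Γ')) (weaken (↑ Γ') (s≤s le) d))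

  weaken : ∀ {Δ Δ' Γ e a} Γ' → Δ ≤ Δ' → Δ ⨾ Γ ⊢ e ∶ a → Δ' ⨾ (Γ ++ Γ') ⊢ e ∶ a
  weaken Γ' le (⊢val d)      = ⊢val (weakenᵛ Γ' le d)
  weaken Γ' le ⊢¿            = ⊢¿
  weaken Γ' le (⊢π₁ d)       = ⊢π₁ (weakenᵛ Γ' le d)
  weaken Γ' le (⊢π₂ d)       = ⊢π₂ (weakenᵛ Γ' le d)
  weaken Γ' le (⊢app d e)    = ⊢app (weakenᵛ Γ' le d) (weaken Γ' le e)
  weaken Γ' le (⊢case d bs)  = ⊢case (weakenᵛ Γ' le d) (weakenBranches Γ' le bs)
  weaken Γ' le (⊢tapp d w)   = ⊢tapp (weakenᵛ Γ' le d) (wf-mono le w)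

  weakenBranches : ∀ {Δ Δ' Γ m as es σ} Γ' → Δ ≤ Δ'
                 → Pointwise (λ a e → Δ ⨾ (a [ m ]ᵗ ∷ Γ) ⊢ e ∶ σ) as es
                 → Pointwise (λ a e → Δ' ⨾ (a [ m ]ᵗ ∷ (Γ ++ Γ')) ⊢ e ∶ σ) as es
  weakenBranches Γ' le []       = []
  weakenBranches Γ' le (d ∷ ds) = weaken Γ' le d ∷ weakenBranches Γ' le ds

numeral-typed : ∀ n → Valof nat (numeral n)
numeral-typed zero    = ⊢inj (wf-μ (wf-𝟏 ∷ wf-var (s≤s z≤n) ∷ [])) refl ⊢⟨⟩
numeral-typed (suc n) = ⊢inj (wf-μ (wf-𝟏 ∷ wf-var (s≤s z≤n) ∷ [])) refl (numeral-typed n)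

-- Substitutions that are the identity on the variables of Γ leave terms
-- typed in Γ unchanged; in particular closed terms are invariant under all
-- renamings and (type or term) substitutions.

FixesCtxʳ : Ctx → (ℕ → ℕ) → Set
FixesCtxʳ Γ ρ = ∀ {x b} → Γ ∋ x ∶ b → ρ x ≡ x

fixesCtxʳ-ext : ∀ {Γ a ρ} → FixesCtxʳ Γ ρ → FixesCtxʳ (a ∷ Γ) (ext ρ)
fixesCtxʳ-ext h here      = refl
fixesCtxʳ-ext h (there p) = cong suc (h p)

fixesCtxʳ-↑ : ∀ {Γ ρ} → FixesCtxʳ Γ ρ → FixesCtxʳ (↑ Γ) ρ
fixesCtxʳ-↑ h p = h (proj₂ (proj₂ (∋-unshift p)))

mutual
  renV-fix : ∀ {Δ Γ v a ρ} → FixesCtxʳ Γ ρ → Δ ⨾ Γ ⊢ᵛ v ∶ a → renV ρ v ≡ v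
  renV-fix h (⊢var p)      = cong var (h p)
  renV-fix h ⊢⟨⟩           = refl
  renV-fix h (⊢pair d e)   = cong₂ ⟨_,_⟩ (renV-fix h d) (renV-fix h e)
  renV-fix h (⊢ƛ w d)      = cong ƛ (renT-fix (fixesCtxʳ-ext h) d)
  renV-fix h (⊢inj w eq d) = cong (inj _) (renV-fix h d)
  renV-fix h (⊢Λ d)        = cong Λ (renT-fix (fixesCtxʳ-↑ h) d)

  renT-fix : ∀ {Δ Γ e a ρ} → FixesCtxʳ Γ ρ → Δ ⨾ Γ ⊢ e ∶ a → renT ρ e ≡ e
  renT-fix h (⊢val d)     = cong val (renV-fix h d)
  renT-fix h ⊢¿           = refl
  renT-fix h (⊢π₁ d)      = cong π₁ (renV-fix h d)
  renT-fix h (⊢π₂ d)      = cong π₂ (renV-fix h d)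
  renT-fix h (⊢app d e)   = cong₂ _·_ (renV-fix h d) (renT-fix h e)
  renT-fix h (⊢case d bs) = cong₂ case (renV-fix h d) (renBranches-fix h bs)
  renT-fix h (⊢tapp d w)  = cong (_⟦ _ ⟧) (renV-fix h d)

  renBranches-fix : ∀ {Δ Γ m as es σ ρ} → FixesCtxʳ Γ ρ
                  → Pointwise (λ a e → Δ ⨾ (a [ m ]ᵗ ∷ Γ) ⊢ e ∶ σ) as es
                  → renTs (ext ρ) es ≡ es
  renBranches-fix h []       = refl
  renBranches-fix h (d ∷ ds) = cong₂ _∷_ (renT-fix (fixesCtxʳ-ext h) d) (renBranches-fix h ds)

FixesCtxˢ : Ctx → (ℕ → Val) → Set
FixesCtxˢ Γ s = ∀ {x b} → Γ ∋ x ∶ b → s x ≡ var x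

fixesCtxˢ-ext : ∀ {Γ a s} → FixesCtxˢ Γ s → FixesCtxˢ (a ∷ Γ) (extsV s)
fixesCtxˢ-ext h here      = refl
fixesCtxˢ-ext h (there p) = cong (renV suc) (h p)

fixesCtxˢ-↑ : ∀ {Γ s} → FixesCtxˢ Γ s → FixesCtxˢ (↑ Γ) (tshiftS s)
fixesCtxˢ-↑ h p = cong (tsubV _) (h (proj₂ (proj₂ (∋-unshift p))))

mutual
  subV-fix : ∀ {Δ Γ v a s} → FixesCtxˢ Γ s → Δ ⨾ Γ ⊢ᵛ v ∶ a → subV s v ≡ v
  subV-fix h (⊢var p)      = h p
  subV-fix h ⊢⟨⟩           = refl
  subV-fix h (⊢pair d e)   = cong₂ ⟨_,_⟩ (subV-fix h d) (subV-fix h e)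
  subV-fix h (⊢ƛ w d)      = cong ƛ (subT-fix (fixesCtxˢ-ext h) d)
  subV-fix h (⊢inj w eq d) = cong (inj _) (subV-fix h d)
  subV-fix h (⊢Λ d)        = cong Λ (subT-fix (fixesCtxˢ-↑ h) d)

  subT-fix : ∀ {Δ Γ e a s} → FixesCtxˢ Γ s → Δ ⨾ Γ ⊢ e ∶ a → subT s e ≡ e
  subT-fix h (⊢val d)     = cong val (subV-fix h d)
  subT-fix h ⊢¿           = refl
  subT-fix h (⊢π₁ d)      = cong π₁ (subV-fix h d)
  subT-fix h (⊢π₂ d)      = cong π₂ (subV-fix h d)
  subT-fix h (⊢app d e)   = cong₂ _·_ (subV-fix h d) (subT-fix h e)
  subT-fix h (⊢case d bs) = cong₂ case (subV-fix h d) (subBranches-fix h bs)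
  subT-fix h (⊢tapp d w)  = cong (_⟦ _ ⟧) (subV-fix h d)

  subBranches-fix : ∀ {Δ Γ m as es σ s} → FixesCtxˢ Γ s
                  → Pointwise (λ a e → Δ ⨾ (a [ m ]ᵗ ∷ Γ) ⊢ e ∶ σ) as es
                  → subTs (extsV s) es ≡ es
  subBranches-fix h []       = refl
  subBranches-fix h (d ∷ ds) = cong₂ _∷_ (subT-fix (fixesCtxˢ-ext h) d) (subBranches-fix h ds)

mutual
  tsubV-fix : ∀ {Δ Γ v a t} → FixesBelow Δ t → Δ ⨾ Γ ⊢ᵛ v ∶ a → tsubV t v ≡ v
  tsubV-fix h (⊢var p)      = refl
  tsubV-fix h ⊢⟨⟩           = refl
  tsubV-fix h (⊢pair d e)   = cong₂ ⟨_,_⟩ (tsubV-fix h d) (tsubV-fix h e)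
  tsubV-fix h (⊢ƛ w d)      = cong ƛ (tsubT-fix h d)
  tsubV-fix h (⊢inj w eq d) = cong (inj _) (tsubV-fix h d)
  tsubV-fix h (⊢Λ d)        = cong Λ (tsubT-fix (fixesBelow-extsTy h) d)

  tsubT-fix : ∀ {Δ Γ e a t} → FixesBelow Δ t → Δ ⨾ Γ ⊢ e ∶ a → tsubT t e ≡ e
  tsubT-fix h (⊢val d)     = cong val (tsubV-fix h d)
  tsubT-fix h ⊢¿           = refl
  tsubT-fix h (⊢π₁ d)      = cong π₁ (tsubV-fix h d)
  tsubT-fix h (⊢π₂ d)      = cong π₂ (tsubV-fix h d)
  tsubT-fix h (⊢app d e)   = cong₂ _·_ (tsubV-fix h d) (tsubT-fix h e)
  tsubT-fix h (⊢case d bs) = cong₂ case (tsubV-fix h d) (tsubBranches-fix h bs)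
  tsubT-fix h (⊢tapp d w)  = cong₂ _⟦_⟧ (tsubV-fix h d) (substTy-fix h w)

  tsubBranches-fix : ∀ {Δ Γ m as es σ t} → FixesBelow Δ t
                   → Pointwise (λ a e → Δ ⨾ (a [ m ]ᵗ ∷ Γ) ⊢ e ∶ σ) as es
                   → tsubTs t es ≡ es
  tsubBranches-fix h []       = refl
  tsubBranches-fix h (d ∷ ds) = cong₂ _∷_ (tsubT-fix h d) (tsubBranches-fix h ds)

-- evaluation contexts v₁ · (v₂ · … [ ]), listed innermost first
plug : List Val → Tm → Tm
plug []      e = e
plug (v ∷ E) e = plug E (v · e)

data EvCtx : List Val → Ty → Ty → Set where
  []  : ∀ {a} → EvCtx [] a a
  _∷_ : ∀ {v E a b c} → Valof (a ⇒ b) v → EvCtx E b c → EvCtx (v ∷ E) a c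

infix 3 _⊑_∶_

_⊑_∶_ : Tm → Tm → Ty → Set
e ⊑ e' ∶ a = ∀ {E c} → EvCtx E a c → plug E e ⇓ → plug E e' ⇓

⊑-trans : ∀ {e₁ e₂ e₃ a} → e₁ ⊑ e₂ ∶ a → e₂ ⊑ e₃ ∶ a → e₁ ⊑ e₃ ∶ a
⊑-trans p q E conv = q E (p E conv)

⊑-app : ∀ {v e e' a b} → Valof (a ⇒ b) v → e ⊑ e' ∶ a → (v · e) ⊑ (v · e') ∶ b
⊑-app dv p E = p (dv ∷ E)

plug-↦ : ∀ E {e e'} → e ↦ e' → plug E e ↦ plug E e'
plug-↦ []      r = r
plug-↦ (v ∷ E) r = plug-↦ E (ξ-app r)

↦⇒⊑ : ∀ {e e₁ a} → e ↦ e₁ → e₁ ⊑ e ∶ a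
↦⇒⊑ r {E} _ (v , rs) = v , (plug-↦ E r ◅ rs)

-- may-contextual approximation implies CIU approximation: a precongruence
-- relates E[e] to E[e'], and it is adequate
≲ctx⇒⊑ : ∀ {e e' a} → 0 ⨾ [] ⊢ e ≲ctx e' ∶ a → e ⊑ e' ∶ a
≲ctx⇒⊑ (T , P , r) E = adequate (relate-plug r E)
  where
    open TypeIndexedRel T
    open IsMayAdequatePrecongruence P
    open Compatible compatible

    relate-plug : ∀ {E e e' a c} → R 0 [] e e' a → EvCtx E a c → R 0 [] (plug E e) (plug E e') c
    relate-plug r []        = r
    relate-plug r (dv ∷ dE) = relate-plug (c-app (refl' ([] , ⊢val dv)) r) dE

-- The replacement relation.  For closed f, g : τ ⇒ σ, Rep Δ Γ e e' a holds
-- when e' is obtained from the term e of type a by replacing some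
-- occurrences of f with g.

module Replacement {τ σ : Ty} (wτσ : WfTy 0 (τ ⇒ σ))
                   {f g : Val} (tf : Valof (τ ⇒ σ) f) (tg : Valof (τ ⇒ σ) g) where

  -- f and g enter through equations so that the relation can be inverted
  -- when the related values are known constructors
  mutual
    data Repᵛ : ℕ → Ctx → Val → Val → Ty → Set where
      r-var  : ∀ {Δ Γ x a} → Γ ∋ x ∶ a → Repᵛ Δ Γ (var x) (var x) a
      r-⟨⟩   : ∀ {Δ Γ} → Repᵛ Δ Γ ⟨⟩ ⟨⟩ 𝟏
      r-pair : ∀ {Δ Γ v v' w w' a b} → Repᵛ Δ Γ v v' a → Repᵛ Δ Γ w w' b
               → Repᵛ Δ Γ ⟨ v , w ⟩ ⟨ v' , w' ⟩ (a ⊗ b)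
      r-ƛ    : ∀ {Δ Γ e e' a b} → WfTy Δ a → Rep Δ (a ∷ Γ) e e' b
               → Repᵛ Δ Γ (ƛ e) (ƛ e') (a ⇒ b)
      r-inj  : ∀ {Δ Γ i v v' as a} → WfTy Δ (μ as) → at as i ≡ just a
               → Repᵛ Δ Γ v v' (a [ μ as ]ᵗ) → Repᵛ Δ Γ (inj i v) (inj i v') (μ as)
      r-Λ    : ∀ {Δ Γ e e' a} → Rep (suc Δ) (↑ Γ) e e' a → Repᵛ Δ Γ (Λ e) (Λ e') (∀' a)
      r-fg   : ∀ {Δ Γ v v'} → v ≡ f → v' ≡ g → Repᵛ Δ Γ v v' (τ ⇒ σ)

    data Rep : ℕ → Ctx → Tm → Tm → Ty → Set where
      r-val  : ∀ {Δ Γ v v' a} → Repᵛ Δ Γ v v' a → Rep Δ Γ (val v) (val v') a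
      r-¿    : ∀ {Δ Γ} → Rep Δ Γ ¿ ¿ nat
      r-π₁   : ∀ {Δ Γ v v' a b} → Repᵛ Δ Γ v v' (a ⊗ b) → Rep Δ Γ (π₁ v) (π₁ v') a
      r-π₂   : ∀ {Δ Γ v v' a b} → Repᵛ Δ Γ v v' (a ⊗ b) → Rep Δ Γ (π₂ v) (π₂ v') b
      r-app  : ∀ {Δ Γ v v' e e' a b} → Repᵛ Δ Γ v v' (a ⇒ b) → Rep Δ Γ e e' a
               → Rep Δ Γ (v · e) (v' · e') b
      r-case : ∀ {Δ Γ v v' as es es' b} → Repᵛ Δ Γ v v' (μ as)
               → RelBranches Rep Δ Γ (μ as) b as es es' → Rep Δ Γ (case v es) (case v' es') b
      r-tapp : ∀ {Δ Γ v v' a b} → Repᵛ Δ Γ v v' (∀' a) → WfTy Δ b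
               → Rep Δ Γ (v ⟦ b ⟧) (v' ⟦ b ⟧) (a [ b ]ᵗ)

  Branches : ℕ → Ctx → Ty → Ty → List Ty → List Tm → Set
  Branches Δ Γ m b as es = Pointwise (λ a e → Δ ⨾ (a [ m ]ᵗ ∷ Γ) ⊢ e ∶ b) as es

  mutual
    Repᵛ-refl : ∀ {Δ Γ v a} → Δ ⨾ Γ ⊢ᵛ v ∶ a → Repᵛ Δ Γ v v a
    Repᵛ-refl (⊢var p)      = r-var p
    Repᵛ-refl ⊢⟨⟩           = r-⟨⟩
    Repᵛ-refl (⊢pair d e)   = r-pair (Repᵛ-refl d) (Repᵛ-refl e)
    Repᵛ-refl (⊢ƛ w d)      = r-ƛ w (Rep-refl d)
    Repᵛ-refl (⊢inj w eq d) = r-inj w eq (Repᵛ-refl d)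
    Repᵛ-refl (⊢Λ d)        = r-Λ (Rep-refl d)

    Rep-refl : ∀ {Δ Γ e a} → Δ ⨾ Γ ⊢ e ∶ a → Rep Δ Γ e e a
    Rep-refl (⊢val d)     = r-val (Repᵛ-refl d)
    Rep-refl ⊢¿           = r-¿
    Rep-refl (⊢π₁ d)      = r-π₁ (Repᵛ-refl d)
    Rep-refl (⊢π₂ d)      = r-π₂ (Repᵛ-refl d)
    Rep-refl (⊢app d e)   = r-app (Repᵛ-refl d) (Rep-refl e)
    Rep-refl (⊢case d bs) = r-case (Repᵛ-refl d) (RepBranches-refl bs)
    Rep-refl (⊢tapp d w)  = r-tapp (Repᵛ-refl d) w

    RepBranches-refl : ∀ {Δ Γ m as es b} → Branches Δ Γ m b as es
                     → RelBranches Rep Δ Γ m b as es es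
    RepBranches-refl []       = []
    RepBranches-refl (d ∷ ds) = Rep-refl d ∷ RepBranches-refl ds

  mutual
    Repᵛ-typed : ∀ {Δ Γ v v' a} → Repᵛ Δ Γ v v' a → (Δ ⨾ Γ ⊢ᵛ v ∶ a) × (Δ ⨾ Γ ⊢ᵛ v' ∶ a)
    Repᵛ-typed (r-var p) = ⊢var p , ⊢var p
    Repᵛ-typed r-⟨⟩      = ⊢⟨⟩ , ⊢⟨⟩
    Repᵛ-typed (r-pair d e) with Repᵛ-typed d | Repᵛ-typed e
    ... | d₁ , d₂ | e₁ , e₂ = ⊢pair d₁ e₁ , ⊢pair d₂ e₂
    Repᵛ-typed (r-ƛ w d) with Rep-typed d
    ... | d₁ , d₂ = ⊢ƛ w d₁ , ⊢ƛ w d₂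
    Repᵛ-typed (r-inj w eq d) with Repᵛ-typed d
    ... | d₁ , d₂ = ⊢inj w eq d₁ , ⊢inj w eq d₂
    Repᵛ-typed (r-Λ d) with Rep-typed d
    ... | d₁ , d₂ = ⊢Λ d₁ , ⊢Λ d₂
    Repᵛ-typed {Δ} {Γ} (r-fg refl refl) = weakenᵛ Γ z≤n tf , weakenᵛ Γ z≤n tg

    Rep-typed : ∀ {Δ Γ e e' a} → Rep Δ Γ e e' a → (Δ ⨾ Γ ⊢ e ∶ a) × (Δ ⨾ Γ ⊢ e' ∶ a)
    Rep-typed (r-val d) with Repᵛ-typed d
    ... | d₁ , d₂ = ⊢val d₁ , ⊢val d₂
    Rep-typed r-¿ = ⊢¿ , ⊢¿
    Rep-typed (r-π₁ d) with Repᵛ-typed d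
    ... | d₁ , d₂ = ⊢π₁ d₁ , ⊢π₁ d₂
    Rep-typed (r-π₂ d) with Repᵛ-typed d
    ... | d₁ , d₂ = ⊢π₂ d₁ , ⊢π₂ d₂
    Rep-typed (r-app d e) with Repᵛ-typed d | Rep-typed e
    ... | d₁ , d₂ | e₁ , e₂ = ⊢app d₁ e₁ , ⊢app d₂ e₂
    Rep-typed (r-case d bs) with Repᵛ-typed d | RepBranches-typed bs
    ... | d₁ , d₂ | b₁ , b₂ = ⊢case d₁ b₁ , ⊢case d₂ b₂
    Rep-typed (r-tapp d w) with Repᵛ-typed d
    ... | d₁ , d₂ = ⊢tapp d₁ w , ⊢tapp d₂ w

    RepBranches-typed : ∀ {Δ Γ m as es es' b} → RelBranches Rep Δ Γ m b as es es'
                      → Branches Δ Γ m b as es × Branches Δ Γ m b as es'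
    RepBranches-typed [] = [] , []
    RepBranches-typed (d ∷ ds) with Rep-typed d | RepBranches-typed ds
    ... | d₁ , d₂ | b₁ , b₂ = (d₁ ∷ b₁) , (d₂ ∷ b₂)

  RenOK : Ctx → Ctx → (ℕ → ℕ) → Set
  RenOK Γ Γ' ρ = ∀ {x b} → Γ ∋ x ∶ b → Γ' ∋ ρ x ∶ b

  renOK-ext : ∀ {Γ Γ' a ρ} → RenOK Γ Γ' ρ → RenOK (a ∷ Γ) (a ∷ Γ') (ext ρ)
  renOK-ext h here      = here
  renOK-ext h (there p) = there (h p)

  renOK-↑ : ∀ {Γ Γ' ρ} → RenOK Γ Γ' ρ → RenOK (↑ Γ) (↑ Γ') ρ
  renOK-↑ h p with ∋-unshift p
  ... | _ , refl , q = ∋-shift (h q)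

  mutual
    Repᵛ-ren : ∀ {Δ Γ Γ' v v' a ρ} → RenOK Γ Γ' ρ → Repᵛ Δ Γ v v' a
             → Repᵛ Δ Γ' (renV ρ v) (renV ρ v') a
    Repᵛ-ren h (r-var p)        = r-var (h p)
    Repᵛ-ren h r-⟨⟩             = r-⟨⟩
    Repᵛ-ren h (r-pair d e)     = r-pair (Repᵛ-ren h d) (Repᵛ-ren h e)
    Repᵛ-ren h (r-ƛ w d)        = r-ƛ w (Rep-ren (renOK-ext h) d)
    Repᵛ-ren h (r-inj w eq d)   = r-inj w eq (Repᵛ-ren h d)
    Repᵛ-ren h (r-Λ d)          = r-Λ (Rep-ren (renOK-↑ h) d)
    Repᵛ-ren h (r-fg refl refl) = r-fg (renV-fix (λ ()) tf) (renV-fix (λ ()) tg)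

    Rep-ren : ∀ {Δ Γ Γ' e e' a ρ} → RenOK Γ Γ' ρ → Rep Δ Γ e e' a
            → Rep Δ Γ' (renT ρ e) (renT ρ e') a
    Rep-ren h (r-val d)     = r-val (Repᵛ-ren h d)
    Rep-ren h r-¿           = r-¿
    Rep-ren h (r-π₁ d)      = r-π₁ (Repᵛ-ren h d)
    Rep-ren h (r-π₂ d)      = r-π₂ (Repᵛ-ren h d)
    Rep-ren h (r-app d e)   = r-app (Repᵛ-ren h d) (Rep-ren h e)
    Rep-ren h (r-case d bs) = r-case (Repᵛ-ren h d) (RepBranches-ren h bs)
    Rep-ren h (r-tapp d w)  = r-tapp (Repᵛ-ren h d) w

    RepBranches-ren : ∀ {Δ Γ Γ' m as es es' b ρ} → RenOK Γ Γ' ρ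
                    → RelBranches Rep Δ Γ m b as es es'
                    → RelBranches Rep Δ Γ' m b as (renTs (ext ρ) es) (renTs (ext ρ) es')
    RepBranches-ren h []       = []
    RepBranches-ren h (d ∷ ds) = Rep-ren (renOK-ext h) d ∷ RepBranches-ren h ds

  mutual
    Repᵛ-tsub : ∀ {Δ Δ' Γ v v' a t} → WfSub Δ Δ' t → Repᵛ Δ Γ v v' a
              → Repᵛ Δ' (substTys t Γ) (tsubV t v) (tsubV t v') (substTy t a)
    Repᵛ-tsub {t = t} h (r-var p) = r-var (∋-substTys t p)
    Repᵛ-tsub h r-⟨⟩              = r-⟨⟩
    Repᵛ-tsub h (r-pair d e)      = r-pair (Repᵛ-tsub h d) (Repᵛ-tsub h e)
    Repᵛ-tsub h (r-ƛ w d)         = r-ƛ (wf-substTy h w) (Rep-tsub h d)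
    Repᵛ-tsub {t = t} h (r-inj {as = as} {a = a} w eq d) =
      r-inj (wf-substTy h w) (at-substTys (extsTy t) as _ a eq)
            (subst (Repᵛ _ _ _ _) (substTy-[]ᵗ t a (μ as)) (Repᵛ-tsub h d))
    Repᵛ-tsub {Γ = Γ} {t = t} h (r-Λ d) =
      r-Λ (subst (λ G → Rep _ G _ _ _) (substTys-shift t Γ) (Rep-tsub (wfSub-extsTy h) d))
    Repᵛ-tsub {t = t} h (r-fg refl refl) =
      subst (Repᵛ _ _ _ _) (sym (substTy-fix (λ n ()) wτσ))
            (r-fg (tsubV-fix (λ n ()) tf) (tsubV-fix (λ n ()) tg))

    Rep-tsub : ∀ {Δ Δ' Γ e e' a t} → WfSub Δ Δ' t → Rep Δ Γ e e' a
             → Rep Δ' (substTys t Γ) (tsubT t e) (tsubT t e') (substTy t a)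
    Rep-tsub h (r-val d)     = r-val (Repᵛ-tsub h d)
    Rep-tsub h r-¿           = r-¿
    Rep-tsub h (r-π₁ d)      = r-π₁ (Repᵛ-tsub h d)
    Rep-tsub h (r-π₂ d)      = r-π₂ (Repᵛ-tsub h d)
    Rep-tsub h (r-app d e)   = r-app (Repᵛ-tsub h d) (Rep-tsub h e)
    Rep-tsub h (r-case d bs) = r-case (Repᵛ-tsub h d) (RepBranches-tsub h bs)
    Rep-tsub {t = t} h (r-tapp {a = a} {b = b} d w) =
      subst (Rep _ _ _ _) (sym (substTy-[]ᵗ t a b)) (r-tapp (Repᵛ-tsub h d) (wf-substTy h w))

    RepBranches-tsub : ∀ {Δ Δ' Γ ms as es es' b t} → WfSub Δ Δ' t
                     → RelBranches Rep Δ Γ (μ ms) b as es es'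
                     → RelBranches Rep Δ' (substTys t Γ) (μ (substTys (extsTy t) ms)) (substTy t b)
                                   (substTys (extsTy t) as) (tsubTs t es) (tsubTs t es')
    RepBranches-tsub h [] = []
    RepBranches-tsub {Γ = Γ} {ms = ms} {t = t} h (_∷_ {a = a} d ds) =
      subst (λ A → Rep _ (A ∷ substTys t Γ) _ _ _) (substTy-[]ᵗ t a (μ ms)) (Rep-tsub h d)
      ∷ RepBranches-tsub h ds

  SubRep : ℕ → Ctx → Ctx → (ℕ → Val) → (ℕ → Val) → Set
  SubRep Δ Γ Γ' s s' = ∀ {x b} → Γ ∋ x ∶ b → Repᵛ Δ Γ' (s x) (s' x) b

  subRep-ext : ∀ {Δ Γ Γ' a s s'} → SubRep Δ Γ Γ' s s'
             → SubRep Δ (a ∷ Γ) (a ∷ Γ') (extsV s) (extsV s')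
  subRep-ext h here      = r-var here
  subRep-ext h (there p) = Repᵛ-ren there (h p)

  subRep-↑ : ∀ {Δ Γ Γ' s s'} → SubRep Δ Γ Γ' s s'
           → SubRep (suc Δ) (↑ Γ) (↑ Γ') (tshiftS s) (tshiftS s')
  subRep-↑ {Γ' = Γ'} h p with ∋-unshift p
  ... | b₀ , refl , q =
    subst₂ (λ G A → Repᵛ _ G _ _ A) (sym (renTys-as-substTys suc Γ')) (sym (renTy-as-substTy suc b₀))
           (Repᵛ-tsub (λ n p → wf-var (s≤s p)) (h q))

  mutual
    Repᵛ-sub : ∀ {Δ Γ Γ' v v' a s s'} → SubRep Δ Γ Γ' s s' → Repᵛ Δ Γ v v' a
             → Repᵛ Δ Γ' (subV s v) (subV s' v') a
    Repᵛ-sub h (r-var p)        = h p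
    Repᵛ-sub h r-⟨⟩             = r-⟨⟩
    Repᵛ-sub h (r-pair d e)     = r-pair (Repᵛ-sub h d) (Repᵛ-sub h e)
    Repᵛ-sub h (r-ƛ w d)        = r-ƛ w (Rep-sub (subRep-ext h) d)
    Repᵛ-sub h (r-inj w eq d)   = r-inj w eq (Repᵛ-sub h d)
    Repᵛ-sub h (r-Λ d)          = r-Λ (Rep-sub (subRep-↑ h) d)
    Repᵛ-sub h (r-fg refl refl) = r-fg (subV-fix (λ ()) tf) (subV-fix (λ ()) tg)

    Rep-sub : ∀ {Δ Γ Γ' e e' a s s'} → SubRep Δ Γ Γ' s s' → Rep Δ Γ e e' a
            → Rep Δ Γ' (subT s e) (subT s' e') a
    Rep-sub h (r-val d)     = r-val (Repᵛ-sub h d)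
    Rep-sub h r-¿           = r-¿
    Rep-sub h (r-π₁ d)      = r-π₁ (Repᵛ-sub h d)
    Rep-sub h (r-π₂ d)      = r-π₂ (Repᵛ-sub h d)
    Rep-sub h (r-app d e)   = r-app (Repᵛ-sub h d) (Rep-sub h e)
    Rep-sub h (r-case d bs) = r-case (Repᵛ-sub h d) (RepBranches-sub h bs)
    Rep-sub h (r-tapp d w)  = r-tapp (Repᵛ-sub h d) w

    RepBranches-sub : ∀ {Δ Γ Γ' m as es es' b s s'} → SubRep Δ Γ Γ' s s'
                    → RelBranches Rep Δ Γ m b as es es'
                    → RelBranches Rep Δ Γ' m b as (subTs (extsV s) es) (subTs (extsV s') es')
    RepBranches-sub h []       = []
    RepBranches-sub h (d ∷ ds) = Rep-sub (subRep-ext h) d ∷ RepBranches-sub h ds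

  Rep-[]ᵛ : ∀ {e e' w w' a b} → Rep 0 (a ∷ []) e e' b → Repᵛ 0 [] w w' a
          → Rep 0 [] (e [ w ]ᵛ) (e' [ w' ]ᵛ) b
  Rep-[]ᵛ d dw = Rep-sub related d
    where
      related : SubRep 0 (_ ∷ []) [] (single _ var) (single _ var)
      related here = dw

  Rep-[]ᵀ : ∀ {e e' a b} → Rep 1 [] e e' a → WfTy 0 b
          → Rep 0 [] (e [ b ]ᵀ) (e' [ b ]ᵀ) (a [ b ]ᵗ)
  Rep-[]ᵀ d w = Rep-tsub wfSingle d
    where
      wfSingle : WfSub 1 0 (single _ tvar)
      wfSingle zero    p         = w
      wfSingle (suc n) (s≤s ())

  RepBranches-at : ∀ {Δ Γ m b as es es' j eⱼ a} → RelBranches Rep Δ Γ m b as es es'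
                 → at es j ≡ just eⱼ → at as j ≡ just a
                 → Σ Tm (λ eⱼ' → (at es' j ≡ just eⱼ') × Rep Δ (a [ m ]ᵗ ∷ Γ) eⱼ eⱼ' b)
  RepBranches-at {j = zero}  (d ∷ ds) refl refl = _ , refl , d
  RepBranches-at {j = suc j} (d ∷ ds) p    q    = RepBranches-at ds p q

  module Simulation (fw⊑gw : ∀ w → Valof τ w → (f · val w) ⊑ (g · val w) ∶ σ) where

    -- the replaced redex: f = ƛ b steps to b[w]; its partner b[w'] is a reduct
    -- of f · w', which approximates g · w'
    step-f : ∀ {b w w'} → ƛ b ≡ f → Repᵛ 0 [] w w' τ
           → Σ Tm (λ e₁' → Rep 0 [] (b [ w ]ᵛ) e₁' σ × e₁' ⊑ (g · val w') ∶ σ)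
    step-f {w' = w'} ƛb≡f dw with subst (Valof (τ ⇒ σ)) (sym ƛb≡f) tf
    ... | ⊢ƛ _ tb =
      _ , Rep-[]ᵛ (Rep-refl tb) dw ,
      ⊑-trans (↦⇒⊑ β-ƛ)
              (subst (λ h → (h · val w') ⊑ (g · val w') ∶ σ) (sym ƛb≡f)
                     (fw⊑gw w' (proj₂ (Repᵛ-typed dw))))

    step : ∀ {e e' e₁ a} → Rep 0 [] e e' a → e ↦ e₁
         → Σ Tm (λ e₁' → Rep 0 [] e₁ e₁' a × e₁' ⊑ e' ∶ a)
    step (r-π₁ (r-pair dv dw))               β-π₁     = _ , r-val dv , ↦⇒⊑ β-π₁
    step (r-π₂ (r-pair dv dw))               β-π₂     = _ , r-val dw , ↦⇒⊑ β-π₂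
    step (r-app (r-ƛ w db) (r-val dw))       β-ƛ      = _ , Rep-[]ᵛ db dw , ↦⇒⊑ β-ƛ
    step (r-app (r-fg ƛb≡f refl) (r-val dw)) β-ƛ      = step-f ƛb≡f dw
    step (r-tapp (r-Λ db) w)                 β-Λ      = _ , Rep-[]ᵀ db w , ↦⇒⊑ β-Λ
    step (r-case (r-inj w eqa dv) bs)        (β-case eq) with RepBranches-at bs eq eqa
    ... | _ , eq' , dⱼ = _ , Rep-[]ᵛ dⱼ dv , ↦⇒⊑ (β-case eq')
    step r-¿                                 (β-¿ n)  = _ , r-val (Repᵛ-refl (numeral-typed n)) , ↦⇒⊑ (β-¿ n)
    step (r-app dv d)                        (ξ-app r) with step d r
    ... | _ , d₁ , e₁'⊑e' = _ , r-app dv d₁ , ⊑-app (proj₂ (Repᵛ-typed dv)) e₁'⊑e'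

    Rep-adequate : ∀ {e e' a v} → Rep 0 [] e e' a → Star _↦_ e (val v) → e' ⇓
    Rep-adequate (r-val d) ε        = _ , ε
    Rep-adequate d         (r ◅ rs) with step d r
    ... | _ , d₁ , e₁'⊑e' = e₁'⊑e' [] (Rep-adequate d₁ rs)

    Rep*-adequate : ∀ {e e' a} → Star (λ x y → Rep 0 [] x y a) e e' → e ⇓ → e' ⇓
    Rep*-adequate ε        conv     = conv
    Rep*-adequate (d ◅ ds) (v , rs) = Rep*-adequate ds (Rep-adequate d rs)

  Rep* : TRel
  Rep* Δ Γ e e' a = Typed Δ Γ e a × Typed Δ Γ e' a × Star (λ x y → Rep Δ Γ x y a) e e'

  lift* : ∀ {Δ Γ Δ' Γ' a b v v'} (C : Val → Tm)
        → (∀ {x y} → Repᵛ Δ Γ x y a → Rep Δ' Γ' (C x) (C y) b)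
        → Star (λ x y → Rep Δ Γ x y a) (val v) (val v')
        → Star (λ x y → Rep Δ' Γ' x y b) (C v) (C v')
  lift* C F ε              = ε
  lift* C F (r-val d ◅ rs) = F d ◅ lift* C F rs

  valTyped : ∀ {Δ Γ v a} → Δ ⨾ Γ ⊢ val v ∶ a → Δ ⨾ Γ ⊢ᵛ v ∶ a
  valTyped (⊢val d) = d

  branchesTyped : ∀ {Δ Γ m as es es' b} → RelBranches Rep* Δ Γ m b as es es'
                → Branches Δ Γ m b as es × Branches Δ Γ m b as es'
  branchesTyped []                              = [] , []
  branchesTyped (((_ , t) , (_ , t') , _) ∷ rs) with branchesTyped rs
  ... | ts , ts' = (t ∷ ts) , (t' ∷ ts')

  -- related branch lists are connected by a chain replacing one branch at a time
  branches* : ∀ {Δ Γ m as es es' b} → RelBranches Rep* Δ Γ m b as es es'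
            → Star (λ xs ys → RelBranches Rep Δ Γ m b as xs ys) es es'
  branches* [] = ε
  branches* (_∷_ {es = es} (_ , (_ , t') , chain) rs) =
    gmap (_∷ es) (_∷ RepBranches-refl (proj₁ (branchesTyped rs))) chain
    ◅◅ gmap (_ ∷_) (Rep-refl t' ∷_) (branches* rs)

  wfCtx-tail : ∀ {Δ a Γ} → WfCtx Δ (a ∷ Γ) → WfCtx Δ Γ
  wfCtx-tail (_ ∷ w) = w

  Rep*-compatible : Compatible Rep*
  Rep*-compatible = record
    { c-var  = λ w p → (w , ⊢val (⊢var p)) , (w , ⊢val (⊢var p)) , ε
    ; c-⟨⟩   = λ w → (w , ⊢val ⊢⟨⟩) , (w , ⊢val ⊢⟨⟩) , ε
    ; c-¿    = λ w → (w , ⊢¿) , (w , ⊢¿) , ε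
    ; c-pair = λ { ((w , t₁) , (_ , t₁') , ch₁) ((_ , t₂) , (_ , t₂') , ch₂) →
        (w , ⊢val (⊢pair (valTyped t₁) (valTyped t₂))) ,
        (w , ⊢val (⊢pair (valTyped t₁') (valTyped t₂'))) ,
        (lift* (λ x → val ⟨ x , _ ⟩) (λ d → r-val (r-pair d (Repᵛ-refl (valTyped t₂)))) ch₁
         ◅◅ lift* (λ x → val ⟨ _ , x ⟩) (λ d → r-val (r-pair (Repᵛ-refl (valTyped t₁')) d)) ch₂) }
    ; c-ƛ    = λ { wa ((w , t₁) , (_ , t₁') , ch) →
        (wfCtx-tail w , ⊢val (⊢ƛ wa t₁)) , (wfCtx-tail w , ⊢val (⊢ƛ wa t₁')) ,
        gmap (val ∘ ƛ) (r-val ∘ r-ƛ wa) ch }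
    ; c-inj  = λ { wm eq ((w , t₁) , (_ , t₁') , ch) →
        (w , ⊢val (⊢inj wm eq (valTyped t₁))) , (w , ⊢val (⊢inj wm eq (valTyped t₁'))) ,
        lift* (val ∘ inj _) (r-val ∘ r-inj wm eq) ch }
    ; c-Λ    = λ { {Γ = Γ} ((w , t₁) , (_ , t₁') , ch) →
        (wfCtx-unshift Γ w , ⊢val (⊢Λ t₁)) , (wfCtx-unshift Γ w , ⊢val (⊢Λ t₁')) ,
        gmap (val ∘ Λ) (r-val ∘ r-Λ) ch }
    ; c-π₁   = λ { ((w , t₁) , (_ , t₁') , ch) →
        (w , ⊢π₁ (valTyped t₁)) , (w , ⊢π₁ (valTyped t₁')) , lift* π₁ r-π₁ ch }
    ; c-π₂   = λ { ((w , t₁) , (_ , t₁') , ch) →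
        (w , ⊢π₂ (valTyped t₁)) , (w , ⊢π₂ (valTyped t₁')) , lift* π₂ r-π₂ ch }
    ; c-app  = λ { ((w , t₁) , (_ , t₁') , ch₁) ((_ , t₂) , (_ , t₂') , ch₂) →
        (w , ⊢app (valTyped t₁) t₂) , (w , ⊢app (valTyped t₁') t₂') ,
        (lift* (_· _) (λ d → r-app d (Rep-refl t₂)) ch₁
         ◅◅ gmap (_ ·_) (r-app (Repᵛ-refl (valTyped t₁'))) ch₂) }
    ; c-case = λ { ((w , t₁) , (_ , t₁') , ch) rbs →
        let bs , bs' = branchesTyped rbs in
        (w , ⊢case (valTyped t₁) bs) , (w , ⊢case (valTyped t₁') bs') ,
        (lift* (λ x → case x _) (λ d → r-case d (RepBranches-refl bs)) ch
         ◅◅ gmap (case _) (r-case (Repᵛ-refl (valTyped t₁'))) (branches* rbs)) }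
    ; c-tapp = λ { ((w , t₁) , (_ , t₁') , ch) wb →
        (w , ⊢tapp (valTyped t₁) wb) , (w , ⊢tapp (valTyped t₁') wb) ,
        lift* (_⟦ _ ⟧) (λ d → r-tapp d wb) ch }
    }

≲ctx-ext : (τ σ : Ty) → WfTy 0 (τ ⇒ σ) → (f g : Val) → Valof (τ ⇒ σ) f → Valof (τ ⇒ σ) g
         → ((u : Val) → Valof τ u → 0 ⨾ [] ⊢ (f · val u) ≲ctx (g · val u) ∶ σ)
         → 0 ⨾ [] ⊢ val f ≲ctx val g ∶ (τ ⇒ σ)
≲ctx-ext τ σ wτσ f g tf tg H =
  record { R = Rep* ; typed = λ { (t , t' , _) → t , t' } } ,
  record { refl'      = λ t → t , t , ε
         ; trans'     = λ { (t₁ , _ , ch₁) (_ , t₃ , ch₂) → t₁ , t₃ , (ch₁ ◅◅ ch₂) }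
         ; compatible = Rep*-compatible
         ; adequate   = λ { (_ , _ , chain) → Rep*-adequate chain } } ,
  ([] , ⊢val tf) , ([] , ⊢val tg) , (r-val (r-fg refl refl) ◅ ε)
  where
    open Replacement wτσ tf tg
    open Simulation (λ u tu → ≲ctx⇒⊑ (H u tu))

lemma4p13 : (τ σ : Ty) → WfTy 0 τ → WfTy 0 σ
    → (f g : Val) → Valof (τ ⇒ σ) f → Valof (τ ⇒ σ) g
    → ((u : Val) → Valof τ u → 0 ⨾ [] ⊢ (f · val u) ≅ctx (g · val u) ∶ σ)
    → 0 ⨾ [] ⊢ val f ≅ctx val g ∶ (τ ⇒ σ)
lemma4p13 τ σ wτ wσ f g tf tg H =
  ≲ctx-ext τ σ (wf-⇒ wτ wσ) f g tf tg (λ u tu → proj₁ (H u tu)) ,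
  ≲ctx-ext τ σ (wf-⇒ wτ wσ) g f tg tf (λ u tu → proj₂ (H u tu))
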